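{- Let $G=\langle A,\beta\mid \beta^2=\alpha,\ \beta a\beta^{ -1}=f(a)\ \text{for all } a\in A\rangle$ be a finite non-abelian group of order $2n$ ($n>1$), where $A$ is an abelian subgroup of index $2$, $\alpha\in A$, and $f$ is an automorphism of $A$ of order $2$ with $f(\alpha)=\alpha$. If $\alpha\neq e$, then there is no Cayley graph $\mathrm{Cay}(G,S)$ ($S\subseteq G\setminus\{e\}$) that is a DSRG with parameters $(2n,n-1,\frac{n-1}{2},\frac{n-3}{2},\frac{n-1}{2})$.
   Context: $e$ denotes the identity. For a finite group $H$ and $S\subseteq H\setminus\{e\}$, $\mathrm{Cay}(H,S)$ is the directed graph with vertex set $H$ and an arc from $x$ to $y$ iff $yx^{ -1}\in S$. A DSRG with parameters $(N,k,\mu,\lambda,t)$ is a $k$-regular loopless directed graph on $N$ vertices such that every vertex $x$ has exactly $t$ vertices $z$ with $x\to z$ and $z\to x$, and for vertices $x\ne y$ the number of $z$ with $x\to z\to y$ is $\lambda$ if $x\to y$ and $\mu$ otherwise. -}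

module Defs where

open import Data.Nat using (ℕ; zero; suc; _+_)
open import Data.Bool using (Bool; true; false; if_then_else_; _∧_)
open import Data.Fin using (Fin; zero; suc)
open import Relation.Binary.PropositionalEquality using (_≡_; _≢_)

count : {N : ℕ} → (Fin N → Bool) → ℕ
count {zero} p = 0
count {suc N} p = (if p zero then 1 else 0) + count (λ z → p (suc z))

-- A directed graph on vertex set Fin N is given by its (decidable) arc relation
-- adj x y ≡ true  iff  x → y.
-- DSRG with parameters (N, k, μ, λ, t) (N is the number of vertices, implicit in Fin N).
record IsDSRG {N : ℕ} (adj : Fin N → Fin N → Bool) (k μ lam t : ℕ) : Set where
  field
    loopless : ∀ x → adj x x ≡ false
    outDeg   : ∀ x → count (λ z → adj x z) ≡ k
    inDeg    : ∀ x → count (λ z → adj z x) ≡ k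
    twoWay   : ∀ x → count (λ z → adj x z ∧ adj z x) ≡ t
    paths    : ∀ x y → x ≢ y →
               count (λ z → adj x z ∧ adj z y) ≡ (if adj x y then lam else μ)

-- The transfer V : G → A (V g = g f(g) on A, V g = g² off A) is a homomorphism, and a Cayley
-- DSRG with these parameters satisfies S² + S = μG in the group ring. Summing this identity over
-- the fibres of V outside A, the number c(g) of elements of S ∖ A with the same transfer as g ∉ A
-- satisfies c(g) + 2 Σ_{s ∈ S ∩ A} c(g s⁻¹) = μ ∣ker V ∩ A∣, which determines c 2-adically, so c is
-- constant. Two more double counts then force ∣ker V ∩ A∣ = n, i.e. a f(a) = e on all of A. Hence
-- α = f(α) satisfies α² = e, and right multiplication by α pairs up the elements of A, although
-- ∣A∣ = n = 2μ + 1 is odd.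

module Submission where

open import Defs
open import Level using (0ℓ)
open import Data.Nat using (ℕ; zero; suc; _+_; _*_; _∸_; _≤_; _<_; _^_; _%_; z≤n; s≤s; >-nonZero)
open import Data.Nat.Properties
  using (≤-trans; ≤-total; ≤-antisym; ≤-<-trans; m≤n⇒m≤1+n; m≤m+n; m≤n+m; m<m+n; <-irrefl; +-mono-≤;
         +-comm; +-suc; +-identityʳ; +-cancelˡ-≡; +-cancelʳ-≡; *-comm; *-identityʳ; *-zeroʳ; *-cancelˡ-≡;
         m*n≡0⇒m≡0; m≤n⇒∃[o]m+o≡n; m+n∸n≡m; even≢odd; +-0-commutativeMonoid; +-*-semiring)
open import Data.Nat.DivMod using ([m+kn]%n≡m%n; m<n⇒m%n≡m)
open import Data.Nat.Divisibility using (_∣_; divides; ∣⇒≤)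
open import Data.Nat.Coprimality using (Coprime; coprime-+; 1-coprimeTo; coprime-divisor)
open import Data.Nat.Tactic.RingSolver using (solve; solve-∀)
open import Data.Bool using (Bool; true; false; if_then_else_; _∧_; not)
open import Data.Bool.Properties
  using (∧-comm; ∧-assoc; ∧-zeroʳ; ∧-conicalˡ; ∧-conicalʳ; not-involutive; not-injective; ⇔→≡; ∧-commutativeMonoid)
open import Data.Fin using (Fin; zero; suc; _≟_)
open import Data.Fin.Properties using (_<?_; <-cmp; <-asym)
open import Data.Fin.Permutation using (permutation)
open import Data.Fin.Subset using (Subset; _∈_; _∉_; ∣_∣)
open import Data.List using (_∷_; [])
open import Data.Vec as Vec using (lookup)
open import Data.Vec.Properties using ([]=⇒lookup; lookup⇒[]=)
open import Data.Product using (Σ-syntax; ∃; _×_; _,_)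
open import Data.Sum using (inj₁; inj₂)
open import Algebra.Bundles using (Group; CommutativeMonoid)
open import Algebra.Structures using (IsGroup)
open import Function using (_∘_)
open import Function.Bundles using (_⇔_; mk⇔; Equivalence)
open import Relation.Binary.Definitions using (tri<; tri≈; tri>)
open import Relation.Binary.PropositionalEquality
open import Relation.Nullary using (¬_)
open import Relation.Nullary.Decidable using (⌊_⌋; yes; no; does; does-⇔; dec-true; dec-false)
open import Relation.Nullary.Negation using (contradiction)
open import Algebra.Properties.CommutativeSemigroup
  (CommutativeMonoid.commutativeSemigroup ∧-commutativeMonoid) using (x∙yz≈y∙xz)
open import Algebra.Properties.Semiring.Sum +-*-semiring using (*-distribˡ-sum)
open import Algebra.Properties.CommutativeMonoid.Sum +-0-commutativeMonoid
  using (sum; ∑-comm; ∑-distrib-+; sum-permute; sum-cong-≗)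

-- Counting over Fin N

count≡sum : ∀ {N} (p : Fin N → Bool) → count p ≡ sum (λ x → if p x then 1 else 0)
count≡sum {zero}  p = refl
count≡sum {suc N} p = cong ((if p zero then 1 else 0) +_) (count≡sum (p ∘ suc))

count-cong : ∀ {N} {p q : Fin N → Bool} → (∀ x → p x ≡ q x) → count p ≡ count q
count-cong {zero}  p≗q = refl
count-cong {suc N} p≗q = cong₂ _+_ (cong (if_then 1 else 0) (p≗q zero)) (count-cong (p≗q ∘ suc))

count-false : ∀ N → count {N} (λ _ → false) ≡ 0
count-false zero    = refl
count-false (suc N) = count-false N

count-pos : ∀ {N} (p : Fin N → Bool) x → p x ≡ true → 0 < count p
count-pos p zero    px rewrite px = s≤s z≤n
count-pos p (suc x) px = ≤-trans (count-pos (p ∘ suc) x px) (m≤n+m _ _)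

count-≤ : ∀ {N} (p : Fin N → Bool) → count p ≤ N
count-≤ {zero}  p = z≤n
count-≤ {suc N} p with p zero
... | true  = s≤s (count-≤ (p ∘ suc))
... | false = m≤n⇒m≤1+n (count-≤ (p ∘ suc))

count-split : ∀ {N} (p q : Fin N → Bool) →
  count p ≡ count (λ x → p x ∧ q x) + count (λ x → p x ∧ not (q x))
count-split {zero}  p q = refl
count-split {suc N} p q with p zero | q zero
... | true  | true  = cong suc (count-split (p ∘ suc) (q ∘ suc))
... | true  | false = trans (cong suc (count-split (p ∘ suc) (q ∘ suc))) (sym (+-suc _ _))
... | false | _     = count-split (p ∘ suc) (q ∘ suc)

count-complement : ∀ {N} (p : Fin N → Bool) → count p + count (not ∘ p) ≡ N
count-complement {zero}  p = refl
count-complement {suc N} p with p zero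
... | true  = cong suc (count-complement (p ∘ suc))
... | false = trans (+-suc _ _) (cong suc (count-complement (p ∘ suc)))

module _ {N : ℕ} {p q : Fin N → Bool} (p⊆q : ∀ x → p x ≡ true → q x ≡ true) where

  count-⊆ : count q ≡ count p + count (λ x → q x ∧ not (p x))
  count-⊆ = trans (count-split q p) (cong (_+ count (λ x → q x ∧ not (p x))) (count-cong q∧p≡p))
    where
    q∧p≡p : ∀ x → q x ∧ p x ≡ p x
    q∧p≡p x with p x in px
    ... | true  = cong (_∧ true) (p⊆q x px)
    ... | false = ∧-zeroʳ (q x)

  count-mono : count p ≤ count q
  count-mono = subst (count p ≤_) (sym count-⊆) (m≤m+n _ _)

  count-strict : ∀ y → q y ≡ true → p y ≡ false → count p < count q
  count-strict y qy py = subst (count p <_) (sym count-⊆)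
    (m<m+n (count p) (count-pos (λ x → q x ∧ not (p x)) y (cong₂ _∧_ qy (cong not py))))

count-permute : ∀ {N} (p : Fin N → Bool) (σ σ⁻¹ : Fin N → Fin N) →
  (∀ x → σ (σ⁻¹ x) ≡ x) → (∀ x → σ⁻¹ (σ x) ≡ x) → count (p ∘ σ) ≡ count p
count-permute p σ σ⁻¹ inv₁ inv₂ = begin
  count (p ∘ σ)                         ≡⟨ count≡sum (p ∘ σ) ⟩
  sum (λ x → if p (σ x) then 1 else 0)  ≡⟨ sum-permute _ (permutation σ σ⁻¹ inv₁ inv₂) ⟨
  sum (λ x → if p x then 1 else 0)      ≡⟨ count≡sum p ⟨
  count p                               ∎
  where open ≡-Reasoning

count-involution-even : ∀ {N} (p : Fin N → Bool) (σ : Fin N → Fin N) →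
  (∀ x → σ (σ x) ≡ x) → (∀ x → σ x ≢ x) → (∀ x → p (σ x) ≡ p x) →
  Σ[ h ∈ ℕ ] count p ≡ 2 * h
count-involution-even p σ σσ σ-free p∘σ = count below , (begin
  count p                                         ≡⟨ count-split p (λ x → ⌊ x <? σ x ⌋) ⟩
  count below + count (λ x → p x ∧ not ⌊ x <? σ x ⌋)
    ≡⟨ cong (count below +_) (count-cong above≡below∘σ) ⟩
  count below + count (below ∘ σ)                 ≡⟨ cong (count below +_) (count-permute below σ σ σσ σσ) ⟩
  count below + count below                       ≡⟨ cong (count below +_) (+-identityʳ _) ⟨
  2 * count below                                 ∎)
  where
  open ≡-Reasoning
  -- Each pair {x , σ x} is counted once, at its smaller element.
  below : Fin _ → Bool
  below x = p x ∧ ⌊ x <? σ x ⌋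
  not-<≡> : ∀ x → not ⌊ x <? σ x ⌋ ≡ ⌊ σ x <? x ⌋
  not-<≡> x with x <? σ x | σ x <? x
  ... | yes x<σx | yes σx<x = contradiction σx<x (<-asym x<σx)
  ... | yes _    | no  _    = refl
  ... | no  _    | yes _    = refl
  ... | no x≮σx  | no σx≮x with <-cmp x (σ x)
  ...   | tri< x<σx _ _ = contradiction x<σx x≮σx
  ...   | tri≈ _ x≡σx _ = contradiction (sym x≡σx) (σ-free x)
  ...   | tri> _ _ σx<x = contradiction σx<x σx≮x
  above≡below∘σ : ∀ x → p x ∧ not ⌊ x <? σ x ⌋ ≡ below (σ x)
  above≡below∘σ x = cong₂ _∧_ (sym (p∘σ x)) (trans (not-<≡> x) (cong (λ y → ⌊ σ x <? y ⌋) (sym (σσ x))))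

sumOver : ∀ {N} → (Fin N → Bool) → (Fin N → ℕ) → ℕ
sumOver p f = sum (λ x → if p x then f x else 0)

module _ {N : ℕ} (p : Fin N → Bool) where

  sumOver-cong : ∀ {f g : Fin N → ℕ} → (∀ x → p x ≡ true → f x ≡ g x) → sumOver p f ≡ sumOver p g
  sumOver-cong {f} {g} f≗g = sum-cong-≗ (λ x → pointwise x (p x) refl)
    where
    pointwise : ∀ x b → p x ≡ b → (if b then f x else 0) ≡ (if b then g x else 0)
    pointwise x true  px = f≗g x px
    pointwise x false px = refl

  sumOver-+ : ∀ (f g : Fin N → ℕ) → sumOver p (λ x → f x + g x) ≡ sumOver p f + sumOver p g
  sumOver-+ f g = trans (sum-cong-≗ (λ x → pointwise (p x)))
    (∑-distrib-+ (λ x → if p x then f x else 0) (λ x → if p x then g x else 0))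
    where
    pointwise : ∀ {x} b → (if b then f x + g x else 0) ≡ (if b then f x else 0) + (if b then g x else 0)
    pointwise true  = refl
    pointwise false = refl

  sumOver-split : ∀ (q : Fin N → Bool) (f : Fin N → ℕ) →
    sumOver p f ≡ sumOver (λ x → p x ∧ q x) f + sumOver (λ x → p x ∧ not (q x)) f
  sumOver-split q f = trans (sum-cong-≗ (λ x → pointwise (p x) (q x)))
    (∑-distrib-+ (λ x → if p x ∧ q x then f x else 0) (λ x → if p x ∧ not (q x) then f x else 0))
    where
    pointwise : ∀ {x} b c → (if b then f x else 0) ≡ (if b ∧ c then f x else 0) + (if b ∧ not c then f x else 0)
    pointwise true  true  = sym (+-identityʳ _)
    pointwise true  false = refl
    pointwise false _     = refl

  sumOver-const : ∀ {f : Fin N → ℕ} c → (∀ x → p x ≡ true → f x ≡ c) → sumOver p f ≡ c * count p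
  sumOver-const {f} c f≡c = begin
    sumOver p f                          ≡⟨ sumOver-cong f≡c ⟩
    sum (λ x → if p x then c else 0)     ≡⟨ sum-cong-≗ (λ x → pointwise (p x)) ⟩
    sum (λ x → c * (if p x then 1 else 0)) ≡⟨ *-distribˡ-sum c (λ x → if p x then 1 else 0) ⟨
    c * sum (λ x → if p x then 1 else 0) ≡⟨ cong (c *_) (count≡sum p) ⟨
    c * count p                          ∎
    where
    open ≡-Reasoning
    pointwise : ∀ b → (if b then c else 0) ≡ c * (if b then 1 else 0)
    pointwise true  = sym (*-identityʳ c)
    pointwise false = sym (*-zeroʳ c)

  sumOver-indicator : ∀ (q : Fin N → Bool) → sumOver p (λ x → if q x then 1 else 0) ≡ count (λ x → p x ∧ q x)
  sumOver-indicator q = trans (sum-cong-≗ (λ x → pointwise (p x))) (sym (count≡sum (λ x → p x ∧ q x)))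
    where
    pointwise : ∀ {x} b → (if b then (if q x then 1 else 0) else 0) ≡ (if b ∧ q x then 1 else 0)
    pointwise true  = refl
    pointwise false = refl

  sumOver-count : ∀ (r : Fin N → Fin N → Bool) →
    sumOver p (λ x → count (r x)) ≡ sum (λ x → count (λ y → p x ∧ r x y))
  sumOver-count r = sum-cong-≗ (λ x → pointwise (p x))
    where
    pointwise : ∀ {x} b → (if b then count (r x) else 0) ≡ count (λ y → b ∧ r x y)
    pointwise true  = refl
    pointwise false = sym (count-false N)

sumOver-swap : ∀ {N} (p q : Fin N → Bool) (r : Fin N → Fin N → Bool) →
  sumOver p (λ x → count (λ y → q y ∧ r x y)) ≡ sumOver q (λ y → count (λ x → p x ∧ r x y))
sumOver-swap p q r = begin
  sumOver p (λ x → count (λ y → q y ∧ r x y))                  ≡⟨ sumOver-count p _ ⟩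
  sum (λ x → count (λ y → p x ∧ (q y ∧ r x y)))                ≡⟨ sum-cong-≗ (λ x → count≡sum (pqr x)) ⟩
  sum (λ x → sum (λ y → if p x ∧ (q y ∧ r x y) then 1 else 0)) ≡⟨ ∑-comm (λ x y → if pqr x y then 1 else 0) ⟩
  sum (λ y → sum (λ x → if p x ∧ (q y ∧ r x y) then 1 else 0))
    ≡⟨ sum-cong-≗ (λ y → sum-cong-≗ (λ x → cong (if_then 1 else 0) (x∙yz≈y∙xz (p x) (q y) (r x y)))) ⟩
  sum (λ y → sum (λ x → if q y ∧ (p x ∧ r x y) then 1 else 0)) ≡⟨ sum-cong-≗ (λ y → count≡sum (qpr y)) ⟨
  sum (λ y → count (λ x → q y ∧ (p x ∧ r x y)))                ≡⟨ sumOver-count q _ ⟨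
  sumOver q (λ y → count (λ x → p x ∧ r x y))                  ∎
  where
  open ≡-Reasoning
  pqr qpr : Fin _ → Fin _ → Bool
  pqr x y = p x ∧ (q y ∧ r x y)
  qpr y x = q y ∧ (p x ∧ r x y)

-- Congruences of natural numbers

infix 4 _≡_[mod_]

_≡_[mod_] : ℕ → ℕ → ℕ → Set
x ≡ y [mod m ] = Σ[ u ∈ ℕ ] Σ[ v ∈ ℕ ] x + u * m ≡ y + v * m

≡-mod-refl : ∀ {m} x → x ≡ x [mod m ]
≡-mod-refl x = 0 , 0 , refl

≡-mod-1 : ∀ x y → x ≡ y [mod 1 ]
≡-mod-1 x y = y , x , solve (x ∷ y ∷ [])

+-≡-mod : ∀ {m a b c d} → a ≡ b [mod m ] → c ≡ d [mod m ] → a + c ≡ b + d [mod m ]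
+-≡-mod {m} {a} {b} {c} {d} (u , v , a≡b) (u′ , v′ , c≡d) = u + u′ , v + v′ , (begin
  a + c + (u + u′) * m        ≡⟨ solve (a ∷ c ∷ m ∷ u ∷ u′ ∷ []) ⟩
  (a + u * m) + (c + u′ * m)  ≡⟨ cong₂ _+_ a≡b c≡d ⟩
  (b + v * m) + (d + v′ * m)  ≡⟨ solve (b ∷ d ∷ m ∷ v ∷ v′ ∷ []) ⟩
  b + d + (v + v′) * m        ∎)
  where open ≡-Reasoning

sumOver-≡-mod : ∀ {N m} (p : Fin N → Bool) {f g : Fin N → ℕ} →
  (∀ x → p x ≡ true → f x ≡ g x [mod m ]) → sumOver p f ≡ sumOver p g [mod m ]
sumOver-≡-mod {zero}  p f≡g = ≡-mod-refl 0
sumOver-≡-mod {suc N} {m} p {f} {g} f≡g = +-≡-mod (head (p zero) refl) (sumOver-≡-mod (p ∘ suc) (f≡g ∘ suc))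
  where
  head : ∀ b → p zero ≡ b → (if b then f zero else 0) ≡ (if b then g zero else 0) [mod m ]
  head true  p₀ = f≡g zero p₀
  head false p₀ = ≡-mod-refl 0

halve-≡-mod : ∀ {m c c′ X X′} → c + 2 * X ≡ c′ + 2 * X′ → X ≡ X′ [mod m ] → c ≡ c′ [mod 2 * m ]
halve-≡-mod {m} {c} {c′} {X} {X′} eq (u , v , X≡X′) = v , u , +-cancelʳ-≡ (2 * X′) _ _ (begin
  c + v * (2 * m) + 2 * X′     ≡⟨ solve (c ∷ m ∷ v ∷ X′ ∷ []) ⟩
  c + 2 * (X′ + v * m)         ≡⟨ cong (λ y → c + 2 * y) X≡X′ ⟨
  c + 2 * (X + u * m)          ≡⟨ solve (c ∷ m ∷ u ∷ X ∷ []) ⟩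
  (c + 2 * X) + u * (2 * m)    ≡⟨ cong (_+ u * (2 * m)) eq ⟩
  (c′ + 2 * X′) + u * (2 * m)  ≡⟨ solve (c′ ∷ m ∷ u ∷ X′ ∷ []) ⟩
  c′ + u * (2 * m) + 2 * X′    ∎)
  where open ≡-Reasoning

≡-mod-bounded : ∀ {m x y} → x < m → y < m → x ≡ y [mod m ] → x ≡ y
≡-mod-bounded {suc m} {x} {y} x<m y<m (u , v , eq) = begin
  x                     ≡⟨ m<n⇒m%n≡m x<m ⟨
  x % suc m             ≡⟨ [m+kn]%n≡m%n x u (suc m) ⟨
  (x + u * suc m) % suc m ≡⟨ cong (_% suc m) eq ⟩
  (y + v * suc m) % suc m ≡⟨ [m+kn]%n≡m%n y v (suc m) ⟩
  y % suc m             ≡⟨ m<n⇒m%n≡m y<m ⟩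
  y                     ∎
  where open ≡-Reasoning

module _ {N : ℕ} (P : Fin N → Set) (T : Fin N → Bool) (c : Fin N → ℕ) (τ : Fin N → Fin N → Fin N) {M : ℕ}
  (τ-closed : ∀ {g s} → P g → T s ≡ true → P (τ g s))
  (balanced : ∀ {g} → P g → c g + 2 * sumOver T (λ s → c (τ g s)) ≡ M) where

  -- A congruence mod 2ʲ between the values of c on P doubles to one mod 2ʲ⁺¹ through the balance equation.
  balanced-≡-mod-2^ : ∀ j {g g′} → P g → P g′ → c g ≡ c g′ [mod 2 ^ j ]
  balanced-≡-mod-2^ zero    {g} {g′} _ _ = ≡-mod-1 (c g) (c g′)
  balanced-≡-mod-2^ (suc j) Pg Pg′ = halve-≡-mod (trans (balanced Pg) (sym (balanced Pg′)))
    (sumOver-≡-mod T (λ s Ts → balanced-≡-mod-2^ j (τ-closed Pg Ts) (τ-closed Pg′ Ts)))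

  balanced⇒constant : ∀ B → (∀ g → c g < 2 ^ B) → ∀ {g g′} → P g → P g′ → c g ≡ c g′
  balanced⇒constant B c<2^B {g} {g′} Pg Pg′ =
    ≡-mod-bounded (c<2^B g) (c<2^B g′) (balanced-≡-mod-2^ B Pg Pg′)

-- Elementary arithmetic

n<2^n : ∀ n → n < 2 ^ n
n<2^n zero    = s≤s z≤n
n<2^n (suc n) = +-mono-≤ (≤-trans (s≤s z≤n) (n<2^n n)) (subst (suc n ≤_) (sym (+-identityʳ _)) (n<2^n n))

private
  root-below : ∀ {s₀ s₁} d → s₀ + s₁ ≡ 2 * (s₁ + d) →
    s₁ * (2 * s₀ + 1) ≡ (s₁ + d) * (2 * (s₁ + d) + 1) → d ≡ 0
  root-below {s₀} {s₁} d sum≡ eq = m*n≡0⇒m≡0 d (1 + 2 * d) (+-cancelˡ-≡ (s₁ * (2 * s₀ + 1)) _ 0 (begin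
    s₁ * (2 * s₀ + 1) + d * (1 + 2 * d)
      ≡⟨ cong (λ s → s₁ * (2 * s + 1) + d * (1 + 2 * d)) s₀≡ ⟩
    s₁ * (2 * (s₁ + 2 * d) + 1) + d * (1 + 2 * d) ≡⟨ solve (s₁ ∷ d ∷ []) ⟩
    (s₁ + d) * (2 * (s₁ + d) + 1)                 ≡⟨ eq ⟨
    s₁ * (2 * s₀ + 1)                             ≡⟨ +-identityʳ _ ⟨
    s₁ * (2 * s₀ + 1) + 0                         ∎))
    where
    open ≡-Reasoning
    s₀≡ : s₀ ≡ s₁ + 2 * d
    s₀≡ = +-cancelʳ-≡ s₁ _ _ (trans sum≡ (solve (s₁ ∷ d ∷ [])))

  root-above : ∀ {μ s₀} d → s₀ + (μ + d) ≡ 2 * μ → (μ + d) * (2 * s₀ + 1) ≡ μ * (2 * μ + 1) → d ≡ 0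
  root-above zero _ _ = refl
  root-above {μ} {s₀} (suc d) sum≡ eq = contradiction (*-cancelˡ-≡ (2 + 2 * d) 1 (suc d) d·2d≡d·1) λ ()
    where
    open ≡-Reasoning
    μ≡ : μ ≡ s₀ + suc d
    μ≡ = +-cancelʳ-≡ μ μ (s₀ + suc d) (begin
      μ + μ               ≡⟨ solve (μ ∷ []) ⟩
      2 * μ               ≡⟨ sum≡ ⟨
      s₀ + (μ + suc d)    ≡⟨ solve (s₀ ∷ d ∷ μ ∷ []) ⟩
      s₀ + suc d + μ      ∎)
    d·2d≡d·1 : suc d * (2 + 2 * d) ≡ suc d * 1
    d·2d≡d·1 = +-cancelˡ-≡ (μ * (2 * μ + 1)) _ _ (begin
      μ * (2 * μ + 1) + suc d * (2 + 2 * d)             ≡⟨ cong (_+ suc d * (2 + 2 * d)) eq ⟨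
      (μ + suc d) * (2 * s₀ + 1) + suc d * (2 + 2 * d)
        ≡⟨ cong (λ m → (m + suc d) * (2 * s₀ + 1) + suc d * (2 + 2 * d)) μ≡ ⟩
      (s₀ + suc d + suc d) * (2 * s₀ + 1) + suc d * (2 + 2 * d) ≡⟨ solve (s₀ ∷ d ∷ []) ⟩
      (s₀ + suc d) * (2 * (s₀ + suc d) + 1) + suc d * 1
        ≡⟨ cong (λ m → m * (2 * m + 1) + suc d * 1) μ≡ ⟨
      μ * (2 * μ + 1) + suc d * 1                       ∎)

-- Substituting s₀ = 2μ − s₁ leaves the quadratic (s₁ − μ)(2s₁ − 2μ − 1) = 0, whose other root is not an integer.
s₁≡μ : ∀ {μ s₀ s₁} → s₀ + s₁ ≡ 2 * μ → s₁ * (2 * s₀ + 1) ≡ μ * (2 * μ + 1) → s₁ ≡ μ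
s₁≡μ {μ} {s₀} {s₁} sum≡ eq with ≤-total s₁ μ
... | inj₁ s₁≤μ with d , refl ← m≤n⇒∃[o]m+o≡n s₁≤μ =
  sym (trans (cong (s₁ +_) (root-below {s₀} {s₁} d sum≡ eq)) (+-identityʳ s₁))
... | inj₂ μ≤s₁ with d , refl ← m≤n⇒∃[o]m+o≡n μ≤s₁ =
  trans (cong (μ +_) (root-above {μ} {s₀} d sum≡ eq)) (+-identityʳ μ)

coprime-2μ+1-μ : ∀ μ → Coprime (2 * μ + 1) μ
coprime-2μ+1-μ μ {d} = subst (λ n → Coprime n μ) μ+[μ+1]≡2μ+1 (coprime-+ (coprime-+ (1-coprimeTo μ))) {d}
  where
  μ+[μ+1]≡2μ+1 : μ + (μ + 1) ≡ 2 * μ + 1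
  μ+[μ+1]≡2μ+1 = solve (μ ∷ [])

-- Eliminating c gives s₁ = μ, and then 2μ + 1 divides kμ while being coprime to μ.
k≡2μ+1 : ∀ {μ s₀ s₁ c k} → s₀ + s₁ ≡ 2 * μ → c * (2 * s₀ + 1) ≡ μ * k → c * (2 * μ + 1) ≡ k * s₁ →
  0 < k → k ≤ 2 * μ + 1 → k ≡ 2 * μ + 1
k≡2μ+1 {μ} {s₀} {s₁} {c} {k} sum≡ eqA eqB 0<k k≤n = ≤-antisym k≤n (∣⇒≤ ⦃ >-nonZero 0<k ⦄ n∣k)
  where
  open ≡-Reasoning
  s₁≡μ′ : s₁ ≡ μ
  s₁≡μ′ = s₁≡μ sum≡ (*-cancelˡ-≡ _ _ k ⦃ >-nonZero 0<k ⦄ (begin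
    k * (s₁ * (2 * s₀ + 1))          ≡⟨ solve (k ∷ s₁ ∷ s₀ ∷ []) ⟩
    (k * s₁) * (2 * s₀ + 1)          ≡⟨ cong (_* (2 * s₀ + 1)) eqB ⟨
    (c * (2 * μ + 1)) * (2 * s₀ + 1) ≡⟨ solve (c ∷ μ ∷ s₀ ∷ []) ⟩
    (2 * μ + 1) * (c * (2 * s₀ + 1)) ≡⟨ cong ((2 * μ + 1) *_) eqA ⟩
    (2 * μ + 1) * (μ * k)            ≡⟨ solve (μ ∷ k ∷ []) ⟩
    k * (μ * (2 * μ + 1))            ∎))
  n∣k : 2 * μ + 1 ∣ k
  n∣k = coprime-divisor (coprime-2μ+1-μ μ) (divides c (begin
    μ * k            ≡⟨ *-comm μ k ⟩
    k * μ            ≡⟨ cong (k *_) s₁≡μ′ ⟨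
    k * s₁           ≡⟨ eqB ⟨
    c * (2 * μ + 1)  ∎))

-- Finite groups and Cayley graphs

∉⇒lookup≡false : ∀ {N} {p : Subset N} {x} → x ∉ p → lookup p x ≡ false
∉⇒lookup≡false {p = p} {x} x∉p with lookup p x in x∈p
... | true  = contradiction (lookup⇒[]= x p x∈p) x∉p
... | false = refl

∣p∣≡count : ∀ {N} (p : Subset N) → ∣ p ∣ ≡ count (lookup p)
∣p∣≡count Vec.[]          = refl
∣p∣≡count (true Vec.∷ p)  = cong suc (∣p∣≡count p)
∣p∣≡count (false Vec.∷ p) = ∣p∣≡count p

module FiniteGroup {N : ℕ} {_∙_ : Fin N → Fin N → Fin N} {e : Fin N} {_⁻¹ : Fin N → Fin N}
  (isGroup : IsGroup _≡_ _∙_ e _⁻¹) where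

  open IsGroup isGroup public using (assoc; identityˡ; identityʳ; inverseʳ; _\\_; _//_)

  group : Group 0ℓ 0ℓ
  group = record { isGroup = isGroup }

  open import Algebra.Properties.Group group public
    using (\\-leftDividesˡ; \\-leftDividesʳ; //-rightDividesˡ; //-rightDividesʳ; ∙-cancelˡ; x≈z//y;
           inverseʳ-unique; identityˡ-unique; identityʳ-unique; ⁻¹-involutive; ⁻¹-anti-homo-∙; ε⁻¹≈ε)
  open import Algebra.Properties.Semigroup (Group.semigroup group) public
    using (uv≈wx⇒yu∙vz≈yw∙xz; uv∙wx≈u[vw∙x])

  count-∙ʳ : ∀ (p : Fin N → Bool) z → count (λ w → p (w ∙ z)) ≡ count p
  count-∙ʳ p z = count-permute p (_∙ z) (_// z) (//-rightDividesˡ z) (//-rightDividesʳ z)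

  count-∙ˡ : ∀ (p : Fin N → Bool) g → count (λ x → p (g ∙ x)) ≡ count p
  count-∙ˡ p g = count-permute p (g ∙_) (g \\_) (\\-leftDividesˡ g) (\\-leftDividesʳ g)

  -- Both sides count the pairs (z , w) with q z, r w and p (w ∙ z).
  sumOver-convolution : ∀ (p q r : Fin N → Bool) →
    sumOver p (λ h → count (λ z → q z ∧ r (h // z))) ≡ sumOver q (λ z → count (λ w → r w ∧ p (w ∙ z)))
  sumOver-convolution p q r = trans (sumOver-swap p q (λ h z → r (h // z))) (sumOver-cong q λ z _ → begin
    count (λ h → p h ∧ r (h // z))               ≡⟨ count-∙ʳ (λ h → p h ∧ r (h // z)) z ⟨
    count (λ w → p (w ∙ z) ∧ r ((w ∙ z) // z))
      ≡⟨ count-cong (λ w → cong (λ y → p (w ∙ z) ∧ r y) (//-rightDividesʳ z w)) ⟩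
    count (λ w → p (w ∙ z) ∧ r w)                ≡⟨ count-cong (λ w → ∧-comm (p (w ∙ z)) (r w)) ⟩
    count (λ w → r w ∧ p (w ∙ z))                ∎)
    where open ≡-Reasoning

  ∙≡⇔≡// : ∀ {x y z} → x ∙ y ≡ z ⇔ x ≡ z // y
  ∙≡⇔≡// {x} {y} {z} = mk⇔ (x≈z//y x y z) (λ x≡z//y → trans (cong (_∙ y) x≡z//y) (//-rightDividesˡ y z))

  ∙≡⇔≡ε : ∀ {x y} → x ∙ y ≡ x ⇔ y ≡ e
  ∙≡⇔≡ε {x} {y} = mk⇔ (identityʳ-unique x y) (λ y≡ε → trans (cong (x ∙_) y≡ε) (identityʳ x))

  x//ε≡x : ∀ x → x // e ≡ x
  x//ε≡x x = trans (cong (x ∙_) ε⁻¹≈ε) (identityʳ x)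

  module CayleyDSRG (S : Subset N) (e∉S : e ∉ S) {k μ lam t : ℕ}
    (dsrg : IsDSRG (λ x y → lookup S (y // x)) k μ lam t) where

    open IsDSRG dsrg

    inS : Fin N → Bool
    inS = lookup S

    private
      walks-from-e : ∀ h → count (λ z → inS z ∧ inS (h // z)) ≡ count (λ z → inS (z // e) ∧ inS (h // z))
      walks-from-e h = count-cong (λ z → cong (λ y → inS y ∧ inS (h // z)) (sym (x//ε≡x z)))

    ∣S∣≡k : count inS ≡ k
    ∣S∣≡k = trans (count-cong (λ z → cong inS (sym (x//ε≡x z)))) (outDeg e)

    -- In the group ring this is S² + S = μ G.
    S²+S≡μG : t ≡ μ → lam + 1 ≡ μ → ∀ h → count (λ z → inS z ∧ inS (h // z)) + (if inS h then 1 else 0) ≡ μ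
    S²+S≡μG t≡μ lam+1≡μ h with h ≟ e
    ... | yes refl = begin
      count (λ z → inS z ∧ inS (e // z)) + (if inS e then 1 else 0)
        ≡⟨ cong₂ _+_ (walks-from-e e) (cong (if_then 1 else 0) (∉⇒lookup≡false e∉S)) ⟩
      count (λ z → inS (z // e) ∧ inS (e // z)) + 0                 ≡⟨ +-identityʳ _ ⟩
      count (λ z → inS (z // e) ∧ inS (e // z))                     ≡⟨ twoWay e ⟩
      t                                                             ≡⟨ t≡μ ⟩
      μ                                                             ∎
      where open ≡-Reasoning
    ... | no h≢e = begin
      count (λ z → inS z ∧ inS (h // z)) + [S]
        ≡⟨ cong (_+ [S]) (trans (walks-from-e h) (paths e h (h≢e ∘ sym))) ⟩
      (if inS (h // e) then lam else μ) + [S]   ≡⟨ cong (λ y → (if inS y then lam else μ) + [S]) (x//ε≡x h) ⟩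
      (if inS h then lam else μ) + [S]          ≡⟨ lam+[S]≡μ (inS h) ⟩
      μ                                         ∎
      where
      open ≡-Reasoning
      [S] : ℕ
      [S] = if inS h then 1 else 0
      lam+[S]≡μ : ∀ b → (if b then lam else μ) + (if b then 1 else 0) ≡ μ
      lam+[S]≡μ true  = lam+1≡μ
      lam+[S]≡μ false = +-identityʳ μ

-- Subgroups of index two and the transfer

module IndexTwo {n : ℕ} {_∙_ : Fin (2 * n) → Fin (2 * n) → Fin (2 * n)} {e : Fin (2 * n)}
  {_⁻¹ : Fin (2 * n) → Fin (2 * n)} (isGroup : IsGroup _≡_ _∙_ e _⁻¹)
  (A : Subset (2 * n)) (e∈A : e ∈ A) (∙-closed : ∀ a b → a ∈ A → b ∈ A → (a ∙ b) ∈ A)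
  (⁻¹-closed : ∀ a → a ∈ A → (a ⁻¹) ∈ A) (∣A∣≡n : ∣ A ∣ ≡ n) where

  open FiniteGroup isGroup

  inA : Fin (2 * n) → Bool
  inA = lookup A

  inA-ε : inA e ≡ true
  inA-ε = []=⇒lookup e∈A

  ∙-closedᵇ : ∀ {a b} → inA a ≡ true → inA b ≡ true → inA (a ∙ b) ≡ true
  ∙-closedᵇ {a} {b} a∈A b∈A = []=⇒lookup (∙-closed a b (lookup⇒[]= a A a∈A) (lookup⇒[]= b A b∈A))

  ⁻¹-closedᵇ : ∀ {a} → inA a ≡ true → inA (a ⁻¹) ≡ true
  ⁻¹-closedᵇ {a} a∈A = []=⇒lookup (⁻¹-closed a (lookup⇒[]= a A a∈A))

  inA-⁻¹ : ∀ x → inA (x ⁻¹) ≡ inA x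
  inA-⁻¹ x = ⇔→≡ (mk⇔ (λ x⁻¹∈A → subst (λ y → inA y ≡ true) (⁻¹-involutive x) (⁻¹-closedᵇ x⁻¹∈A)) ⁻¹-closedᵇ)

  inA-∙ʳ : ∀ {a} x → inA a ≡ true → inA (x ∙ a) ≡ inA x
  inA-∙ʳ {a} x a∈A = ⇔→≡ (mk⇔
    (λ xa∈A → subst (λ y → inA y ≡ true) (//-rightDividesʳ a x) (∙-closedᵇ xa∈A (⁻¹-closedᵇ a∈A)))
    (λ x∈A → ∙-closedᵇ x∈A a∈A))

  inA-∙ˡ : ∀ {a} x → inA a ≡ true → inA (a ∙ x) ≡ inA x
  inA-∙ˡ {a} x a∈A = ⇔→≡ (mk⇔
    (λ ax∈A → subst (λ y → inA y ≡ true) (\\-leftDividesʳ a x) (∙-closedᵇ (⁻¹-closedᵇ a∈A) ax∈A))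
    (λ x∈A → ∙-closedᵇ a∈A x∈A))

  count-inA : count inA ≡ n
  count-inA = trans (sym (∣p∣≡count A)) ∣A∣≡n

  count-∉A : count (not ∘ inA) ≡ n
  count-∉A = +-cancelˡ-≡ n _ _ (begin
    n + count (not ∘ inA)           ≡⟨ cong (_+ count (not ∘ inA)) count-inA ⟨
    count inA + count (not ∘ inA)   ≡⟨ count-complement inA ⟩
    2 * n                           ≡⟨ cong (n +_) (+-identityʳ n) ⟩
    n + n                           ∎)
    where open ≡-Reasoning

  -- b⁻¹A avoids A and has n elements, so it is all of G ∖ A.
  inA-∙-∉∉ : ∀ {b x} → inA b ≡ false → inA x ≡ false → inA (b ∙ x) ≡ true
  inA-∙-∉∉ {b} {x} b∉A x∉A with inA (b ∙ x) in bx∈A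
  ... | true  = refl
  ... | false = contradiction (count-strict b⁻¹A⊆G∖A x (cong not x∉A) bx∈A) (<-irrefl count-b⁻¹A)
    where
    b⁻¹A⊆G∖A : ∀ z → inA (b ∙ z) ≡ true → not (inA z) ≡ true
    b⁻¹A⊆G∖A z bz∈A with inA z in z∈A
    ... | true  = trans (sym (trans (inA-∙ʳ b z∈A) b∉A)) bz∈A
    ... | false = refl
    count-b⁻¹A : count (λ z → inA (b ∙ z)) ≡ count (not ∘ inA)
    count-b⁻¹A = trans (count-∙ˡ inA b) (trans count-inA (sym count-∉A))

  inA-∙ˡ-flip : ∀ {b} x → inA b ≡ false → inA (b ∙ x) ≡ not (inA x)
  inA-∙ˡ-flip {b} x b∉A with inA x in x∈A
  ... | true  = trans (inA-∙ʳ b x∈A) b∉A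
  ... | false = inA-∙-∉∉ b∉A x∈A

  inA-∙ʳ-flip : ∀ {b} x → inA b ≡ false → inA (x ∙ b) ≡ not (inA x)
  inA-∙ʳ-flip {b} x b∉A with inA x in x∈A
  ... | true  = trans (inA-∙ˡ b x∈A) b∉A
  ... | false = inA-∙-∉∉ x∈A b∉A

  module Transfer (∙-comm : ∀ a b → a ∈ A → b ∈ A → a ∙ b ≡ b ∙ a) {β : Fin (2 * n)} (β∉A : inA β ≡ false) where

    open ≡-Reasoning

    comm : ∀ {a b} → inA a ≡ true → inA b ≡ true → a ∙ b ≡ b ∙ a
    comm {a} {b} a∈A b∈A = ∙-comm a b (lookup⇒[]= a A a∈A) (lookup⇒[]= b A b∈A)

    f : Fin (2 * n) → Fin (2 * n)
    f a = β ∙ (a // β)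

    inA-f : ∀ {a} → inA a ≡ true → inA (f a) ≡ true
    inA-f {a} a∈A = trans (inA-∙ˡ-flip (a // β) β∉A)
      (cong not (trans (inA-∙ʳ-flip a (trans (inA-⁻¹ β) β∉A)) (cong not a∈A)))

    f-∙ : ∀ a b → f (a ∙ b) ≡ f a ∙ f b
    f-∙ a b = begin
      β ∙ ((a ∙ b) // β)                      ≡⟨ cong (β ∙_) (assoc a b _) ⟩
      β ∙ (a ∙ (b // β))                      ≡⟨ cong (λ w → β ∙ (a ∙ w)) (\\-leftDividesʳ β _) ⟨
      β ∙ (a ∙ ((β ⁻¹) ∙ (β ∙ (b // β))))      ≡⟨ cong (β ∙_) (assoc a (β ⁻¹) _) ⟨
      β ∙ ((a // β) ∙ (β ∙ (b // β)))        ≡⟨ assoc β _ _ ⟨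
      f a ∙ f b                               ∎

    -- Any two elements outside A differ by an element of A, which commutes with A.
    conj-∉A : ∀ {y a} → inA y ≡ false → inA a ≡ true → y ∙ (a // y) ≡ f a
    conj-∉A {y} {a} y∉A a∈A = begin
      y ∙ (a // y)                            ≡⟨ cong (λ w → w ∙ (a // w)) (\\-leftDividesˡ β y) ⟨
      (β ∙ b) ∙ (a ∙ ((β ∙ b) ⁻¹))              ≡⟨ cong (λ w → (β ∙ b) ∙ (a ∙ w)) (⁻¹-anti-homo-∙ β b) ⟩
      (β ∙ b) ∙ (a ∙ ((b ⁻¹) ∙ (β ⁻¹)))           ≡⟨ cong ((β ∙ b) ∙_) (assoc a (b ⁻¹) _) ⟨
      (β ∙ b) ∙ ((a // b) ∙ (β ⁻¹))             ≡⟨ cong (λ w → (β ∙ b) ∙ (w ∙ (β ⁻¹))) (comm a∈A (⁻¹-closedᵇ b∈A)) ⟩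
      (β ∙ b) ∙ ((b \\ a) ∙ (β ⁻¹))             ≡⟨ assoc β b _ ⟩
      β ∙ (b ∙ ((b \\ a) ∙ (β ⁻¹)))             ≡⟨ cong (β ∙_) (assoc b _ _) ⟨
      β ∙ ((b ∙ (b \\ a)) ∙ (β ⁻¹))             ≡⟨ cong (λ w → β ∙ (w ∙ (β ⁻¹))) (\\-leftDividesˡ b a) ⟩
      f a                                     ∎
      where
      b : Fin (2 * n)
      b = β \\ y
      b∈A : inA b ≡ true
      b∈A = inA-∙-∉∉ (trans (inA-⁻¹ β) β∉A) y∉A

    ∉A-∙-∈A : ∀ {y a} → inA y ≡ false → inA a ≡ true → y ∙ a ≡ f a ∙ y
    ∉A-∙-∈A {y} {a} y∉A a∈A = begin
      y ∙ a               ≡⟨ //-rightDividesˡ y (y ∙ a) ⟨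
      ((y ∙ a) // y) ∙ y  ≡⟨ cong (_∙ y) (trans (assoc y a (y ⁻¹)) (conj-∉A y∉A a∈A)) ⟩
      f a ∙ y             ∎

    ∈A-∙-∉A : ∀ {x a} → inA x ≡ false → inA a ≡ true → a ∙ x ≡ x ∙ f a
    ∈A-∙-∉A {x} {a} x∉A a∈A = begin
      a ∙ x                     ≡⟨ \\-leftDividesˡ x (a ∙ x) ⟨
      x ∙ ((x ⁻¹) ∙ (a ∙ x))    ≡⟨ cong (λ w → x ∙ ((x ⁻¹) ∙ (a ∙ w))) (⁻¹-involutive x) ⟨
      x ∙ ((x ⁻¹) ∙ (a // (x ⁻¹))) ≡⟨ cong (x ∙_) (conj-∉A (trans (inA-⁻¹ x) x∉A) a∈A) ⟩
      x ∙ f a                   ∎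

    -- The transfer G → A computed with the transversal {e , β}.
    transfer : Fin (2 * n) → Fin (2 * n)
    transfer g = if inA g then g ∙ f g else g ∙ g

    transfer-∈A : ∀ {g} → inA g ≡ true → transfer g ≡ g ∙ f g
    transfer-∈A {g} g∈A = cong (λ b → if b then g ∙ f g else g ∙ g) g∈A

    transfer-∉A : ∀ {g} → inA g ≡ false → transfer g ≡ g ∙ g
    transfer-∉A {g} g∉A = cong (λ b → if b then g ∙ f g else g ∙ g) g∉A

    inA-transfer : ∀ g → inA (transfer g) ≡ true
    inA-transfer g with inA g in g∈A
    ... | true  = ∙-closedᵇ g∈A (inA-f g∈A)
    ... | false = inA-∙-∉∉ g∈A g∈A

    transfer-∙ : ∀ x y → transfer (x ∙ y) ≡ transfer x ∙ transfer y
    transfer-∙ x y with inA x in x∈A | inA y in y∈A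
    ... | true | true = begin
      transfer (x ∙ y)          ≡⟨ transfer-∈A (∙-closedᵇ x∈A y∈A) ⟩
      (x ∙ y) ∙ f (x ∙ y)       ≡⟨ cong ((x ∙ y) ∙_) (f-∙ x y) ⟩
      (x ∙ y) ∙ (f x ∙ f y)     ≡⟨ uv≈wx⇒yu∙vz≈yw∙xz (comm y∈A (inA-f x∈A)) x (f y) ⟩
      (x ∙ f x) ∙ (y ∙ f y) ∎
    ... | true | false = begin
      transfer (x ∙ y)          ≡⟨ transfer-∉A (trans (inA-∙ʳ-flip x y∈A) (cong not x∈A)) ⟩
      (x ∙ y) ∙ (x ∙ y)         ≡⟨ uv≈wx⇒yu∙vz≈yw∙xz (∉A-∙-∈A y∈A x∈A) x y ⟩
      (x ∙ f x) ∙ (y ∙ y) ∎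
    ... | false | true = begin
      transfer (x ∙ y)          ≡⟨ transfer-∉A (trans (inA-∙ˡ-flip y x∈A) (cong not y∈A)) ⟩
      (x ∙ y) ∙ (x ∙ y)         ≡⟨ uv≈wx⇒yu∙vz≈yw∙xz (∈A-∙-∉A x∈A y∈A) x y ⟩
      (x ∙ x) ∙ (f y ∙ y)       ≡⟨ cong ((x ∙ x) ∙_) (comm (inA-f y∈A) y∈A) ⟩
      (x ∙ x) ∙ (y ∙ f y) ∎
    ... | false | false = begin
      transfer (x ∙ y)          ≡⟨ transfer-∈A xy∈A ⟩
      (x ∙ y) ∙ f (x ∙ y)       ≡⟨ cong ((x ∙ y) ∙_) (f-conj y∈A xy∈A) ⟩
      (x ∙ y) ∙ (y ∙ x)         ≡⟨ uv∙wx≈u[vw∙x] x y y x ⟩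
      x ∙ ((y ∙ y) ∙ x)         ≡⟨ cong (x ∙_) (trans (∈A-∙-∉A x∈A yy∈A) (cong (x ∙_) (f-conj y∈A yy∈A))) ⟩
      x ∙ (x ∙ (y ∙ y))         ≡⟨ assoc x x (y ∙ y) ⟨
      (x ∙ x) ∙ (y ∙ y) ∎
      where
      xy∈A : inA (x ∙ y) ≡ true
      xy∈A = inA-∙-∉∉ x∈A y∈A
      yy∈A : inA (y ∙ y) ≡ true
      yy∈A = inA-∙-∉∉ y∈A y∈A
      f-conj : ∀ {w z} → inA z ≡ false → inA (w ∙ z) ≡ true → f (w ∙ z) ≡ z ∙ w
      f-conj {w} {z} z∉A wz∈A = trans (sym (conj-∉A z∉A wz∈A)) (cong (z ∙_) (//-rightDividesʳ z w))

    transfer-ε : transfer e ≡ e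
    transfer-ε = identityˡ-unique _ _ (trans (sym (transfer-∙ e e)) (cong transfer (identityˡ e)))

    transfer-⁻¹ : ∀ x → transfer (x ⁻¹) ≡ (transfer x) ⁻¹
    transfer-⁻¹ x = inverseʳ-unique _ _
      (trans (sym (transfer-∙ x (x ⁻¹))) (trans (cong transfer (inverseʳ x)) transfer-ε))

    transfer-// : ∀ x y → transfer (x // y) ≡ transfer x // transfer y
    transfer-// x y = trans (transfer-∙ x (y ⁻¹)) (cong (transfer x ∙_) (transfer-⁻¹ y))

    transfer-∙≡⇔ : ∀ w z g → transfer (w ∙ z) ≡ transfer g ⇔ transfer w ≡ transfer (g // z)
    transfer-∙≡⇔ w z g = mk⇔
      (λ eq → trans (Equivalence.to ∙≡⇔≡// (trans (sym (transfer-∙ w z)) eq)) (sym (transfer-// g z)))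
      (λ eq → trans (transfer-∙ w z) (Equivalence.from ∙≡⇔≡// (trans eq (transfer-// g z))))

    transfer-comm : ∀ w z → transfer (w ∙ z) ≡ transfer (z ∙ w)
    transfer-comm w z = begin
      transfer (w ∙ z)          ≡⟨ transfer-∙ w z ⟩
      transfer w ∙ transfer z   ≡⟨ comm (inA-transfer w) (inA-transfer z) ⟩
      transfer z ∙ transfer w   ≡⟨ transfer-∙ z w ⟨
      transfer (z ∙ w)          ∎

    transfer-∙≡⇔≡ε : ∀ g x → transfer (g ∙ x) ≡ transfer g ⇔ transfer x ≡ e
    transfer-∙≡⇔≡ε g x = mk⇔
      (λ eq → Equivalence.to ∙≡⇔≡ε (trans (sym (transfer-∙ g x)) eq))
      (λ eq → trans (transfer-∙ g x) (Equivalence.from ∙≡⇔≡ε eq))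

    module KernelCount (S : Subset (2 * n)) {μ : ℕ} (2μ+1≡n : 2 * μ + 1 ≡ n) (∣S∣≡2μ : count (lookup S) ≡ 2 * μ)
      (S²+S≡μG : ∀ h → count (λ z → lookup S z ∧ lookup S (h // z)) + (if lookup S h then 1 else 0) ≡ μ) where

      inS : Fin (2 * n) → Bool
      inS = lookup S

      kernelSize : ℕ
      kernelSize = count (λ x → inA x ∧ does (transfer x ≟ e))

      outerFibre : Fin (2 * n) → Fin (2 * n) → Bool
      outerFibre g h = not (inA h) ∧ does (transfer h ≟ transfer g)

      count-outerFibre : ∀ {g} → inA g ≡ false → count (outerFibre g) ≡ kernelSize
      count-outerFibre {g} g∉A = trans (sym (count-∙ˡ (outerFibre g) g)) (count-cong λ x → cong₂ _∧_
        (trans (cong not (inA-∙ˡ-flip x g∉A)) (not-involutive (inA x)))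
        (does-⇔ (transfer-∙≡⇔≡ε g x) (transfer (g ∙ x) ≟ transfer g) (transfer x ≟ e)))

      S∩A S∖A : Fin (2 * n) → Bool
      S∩A x = inS x ∧ inA x
      S∖A x = inS x ∧ not (inA x)

      fibreInS∖A : Fin (2 * n) → ℕ
      fibreInS∖A g = count (λ w → S∖A w ∧ does (transfer w ≟ transfer g))

      fibreSum : Fin (2 * n) → ℕ
      fibreSum g = sumOver S∩A (λ s → fibreInS∖A (g // s))

      private
        walks : Fin (2 * n) → Fin (2 * n) → ℕ
        walks g z = count (λ w → inS w ∧ outerFibre g (w ∙ z))

        walks-inside : ∀ g {z} → inA z ≡ true → walks g z ≡ fibreInS∖A (g // z)
        walks-inside g {z} z∈A = count-cong λ w → begin
          inS w ∧ (not (inA (w ∙ z)) ∧ does (transfer (w ∙ z) ≟ transfer g))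
            ≡⟨ cong₂ (λ a b → inS w ∧ (not a ∧ b)) (inA-∙ʳ w z∈A)
                 (does-⇔ (transfer-∙≡⇔ w z g) (transfer (w ∙ z) ≟ transfer g) (transfer w ≟ transfer (g // z))) ⟩
          inS w ∧ (not (inA w) ∧ does (transfer w ≟ transfer (g // z)))
            ≡⟨ ∧-assoc (inS w) _ _ ⟨
          (inS w ∧ not (inA w)) ∧ does (transfer w ≟ transfer (g // z)) ∎

        walks-outside : ∀ g {z} → inA z ≡ false →
          walks g z ≡ count (λ w → S∩A w ∧ does (transfer z ≟ transfer (g // w)))
        walks-outside g {z} z∉A = count-cong λ w → begin
          inS w ∧ (not (inA (w ∙ z)) ∧ does (transfer (w ∙ z) ≟ transfer g))
            ≡⟨ cong₂ (λ a b → inS w ∧ (a ∧ b))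
                 (trans (cong not (inA-∙ʳ-flip w z∉A)) (not-involutive (inA w)))
                 (trans (cong (λ v → does (v ≟ transfer g)) (transfer-comm w z))
                   (does-⇔ (transfer-∙≡⇔ z w g) (transfer (z ∙ w) ≟ transfer g) (transfer z ≟ transfer (g // w)))) ⟩
          inS w ∧ (inA w ∧ does (transfer z ≟ transfer (g // w)))
            ≡⟨ ∧-assoc (inS w) _ _ ⟨
          (inS w ∧ inA w) ∧ does (transfer z ≟ transfer (g // w)) ∎

      -- Sum S² + S = μG over the fibre of transfer g in G ∖ A, which has kernelSize elements;
      -- the S²-part splits according to whether the right factor lies in A.
      balance : ∀ {g} → inA g ≡ false → fibreInS∖A g + 2 * fibreSum g ≡ μ * kernelSize
      balance {g} g∉A = begin
        fibreInS∖A g + 2 * fibreSum g                           ≡⟨ cong₂ _+_ S∩fibre S²∩fibre ⟨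
        sumOver (outerFibre g) [S] + sumOver (outerFibre g) S²  ≡⟨ +-comm (sumOver (outerFibre g) [S]) _ ⟩
        sumOver (outerFibre g) S² + sumOver (outerFibre g) [S]  ≡⟨ sumOver-+ (outerFibre g) S² [S] ⟨
        sumOver (outerFibre g) (λ h → S² h + [S] h)             ≡⟨ sumOver-const (outerFibre g) μ (λ h _ → S²+S≡μG h) ⟩
        μ * count (outerFibre g)                                ≡⟨ cong (μ *_) (count-outerFibre g∉A) ⟩
        μ * kernelSize                                          ∎
        where
        S² [S] : Fin (2 * n) → ℕ
        S² h = count (λ z → inS z ∧ inS (h // z))
        [S] h = if inS h then 1 else 0
        S∩fibre : sumOver (outerFibre g) [S] ≡ fibreInS∖A g
        S∩fibre = trans (sumOver-indicator (outerFibre g) inS) (count-cong λ h →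
          trans (∧-comm (outerFibre g h) (inS h)) (sym (∧-assoc (inS h) _ _)))
        S²∩fibre : sumOver (outerFibre g) S² ≡ 2 * fibreSum g
        S²∩fibre = begin
          sumOver (outerFibre g) S²                          ≡⟨ sumOver-convolution (outerFibre g) inS inS ⟩
          sumOver inS (walks g)                              ≡⟨ sumOver-split inS inA (walks g) ⟩
          sumOver S∩A (walks g) + sumOver S∖A (walks g)
            ≡⟨ cong₂ _+_ (sumOver-cong S∩A (λ z z∈S∩A → walks-inside g (∧-conicalʳ _ _ z∈S∩A)))
                         (trans (sumOver-cong S∖A (λ z z∈S∖A → walks-outside g (not-injective (∧-conicalʳ _ _ z∈S∖A))))
                                (sumOver-swap S∖A S∩A (λ z w → does (transfer z ≟ transfer (g // w))))) ⟩
          fibreSum g + fibreSum g                            ≡⟨ cong (fibreSum g +_) (+-identityʳ _) ⟨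
          2 * fibreSum g                                     ∎

      private
        //-∉A : ∀ {g s} → inA g ≡ false → S∩A s ≡ true → inA (g // s) ≡ false
        //-∉A {g} g∉A s∈S∩A = trans (inA-∙ʳ g (⁻¹-closedᵇ (∧-conicalʳ _ _ s∈S∩A))) g∉A

      fibreInS∖A-constant : ∀ {g} → inA g ≡ false → fibreInS∖A g ≡ fibreInS∖A β
      fibreInS∖A-constant g∉A = balanced⇒constant (λ g → inA g ≡ false) S∩A fibreInS∖A _//_ //-∉A balance
        (2 * n) (λ g → ≤-<-trans (count-≤ _) (n<2^n (2 * n))) g∉A β∉A

      s₀ s₁ : ℕ
      s₀ = count S∩A
      s₁ = count S∖A

      s₀+s₁≡2μ : s₀ + s₁ ≡ 2 * μ
      s₀+s₁≡2μ = trans (sym (count-split inS inA)) ∣S∣≡2μ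

      balance-at-β : fibreInS∖A β * (2 * s₀ + 1) ≡ μ * kernelSize
      balance-at-β = begin
        c₀ * (2 * s₀ + 1)       ≡⟨ expand c₀ s₀ ⟩
        c₀ + 2 * (c₀ * s₀)
          ≡⟨ cong (λ x → c₀ + 2 * x) (sumOver-const S∩A c₀ (λ s s∈S∩A → fibreInS∖A-constant (//-∉A β∉A s∈S∩A))) ⟨
        c₀ + 2 * fibreSum β     ≡⟨ balance β∉A ⟩
        μ * kernelSize          ∎
        where
        c₀ : ℕ
        c₀ = fibreInS∖A β
        expand : ∀ c s → c * (2 * s + 1) ≡ c + 2 * (c * s)
        expand = solve-∀

      fibreInS∖A-total : fibreInS∖A β * (2 * μ + 1) ≡ kernelSize * s₁
      fibreInS∖A-total = begin
        c₀ * (2 * μ + 1)                                  ≡⟨ cong (c₀ *_) (trans 2μ+1≡n (sym count-∉A)) ⟩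
        c₀ * count (not ∘ inA)
          ≡⟨ sumOver-const (not ∘ inA) c₀ (λ g g∉A → fibreInS∖A-constant (not-injective g∉A)) ⟨
        sumOver (not ∘ inA) fibreInS∖A
          ≡⟨ sumOver-swap (not ∘ inA) S∖A (λ g z → does (transfer z ≟ transfer g)) ⟩
        sumOver S∖A (λ z → count (λ g → not (inA g) ∧ does (transfer z ≟ transfer g)))
          ≡⟨ sumOver-const S∖A kernelSize (λ z z∈S∖A →
               trans (count-cong (λ g → cong (not (inA g) ∧_) (≟-sym z g)))
                     (count-outerFibre (not-injective (∧-conicalʳ _ _ z∈S∖A)))) ⟩
        kernelSize * s₁                                   ∎
        where
        c₀ : ℕ
        c₀ = fibreInS∖A β
        ≟-sym : ∀ z g → does (transfer z ≟ transfer g) ≡ does (transfer g ≟ transfer z)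
        ≟-sym z g = does-⇔ (mk⇔ sym sym) (transfer z ≟ transfer g) (transfer g ≟ transfer z)

      kernel⊆A : ∀ x → inA x ∧ does (transfer x ≟ e) ≡ true → inA x ≡ true
      kernel⊆A x = ∧-conicalˡ _ _

      kernelSize≡n : kernelSize ≡ n
      kernelSize≡n = trans (k≡2μ+1 {μ} {s₀} {s₁} {fibreInS∖A β}
        s₀+s₁≡2μ balance-at-β fibreInS∖A-total 0<kernelSize kernelSize≤) 2μ+1≡n
        where
        0<kernelSize : 0 < kernelSize
        0<kernelSize = count-pos _ e (cong₂ _∧_ inA-ε (dec-true (transfer e ≟ e) transfer-ε))
        kernelSize≤ : kernelSize ≤ 2 * μ + 1
        kernelSize≤ = subst (kernelSize ≤_) (trans count-inA (sym 2μ+1≡n)) (count-mono kernel⊆A)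

      transfer-trivial : ∀ {a} → inA a ≡ true → transfer a ≡ e
      transfer-trivial {a} a∈A with transfer a ≟ e
      ... | yes Va≡ε = Va≡ε
      ... | no  Va≢ε = contradiction (count-strict kernel⊆A a a∈A a∉kernel) (<-irrefl (trans kernelSize≡n (sym count-inA)))
        where
        a∉kernel : inA a ∧ does (transfer a ≟ e) ≡ false
        a∉kernel = trans (cong (_∧ does (transfer a ≟ e)) a∈A) (dec-false (transfer a ≟ e) Va≢ε)

corollary4 : (n : ℕ) → 1 < n →
    (_∙_ : Fin (2 * n) → Fin (2 * n) → Fin (2 * n)) (e : Fin (2 * n))
    (_⁻¹ : Fin (2 * n) → Fin (2 * n)) → IsGroup _≡_ _∙_ e _⁻¹ →
    (∃ λ x → ∃ λ y → x ∙ y ≢ y ∙ x) →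
    (A : Subset (2 * n)) → e ∈ A →
    (∀ a b → a ∈ A → b ∈ A → (a ∙ b) ∈ A) → (∀ a → a ∈ A → (a ⁻¹) ∈ A) →
    (∀ a b → a ∈ A → b ∈ A → a ∙ b ≡ b ∙ a) → ∣ A ∣ ≡ n →
    (β α : Fin (2 * n)) → β ∉ A → β ∙ β ≡ α → α ∈ A →
    (∀ a → a ∈ A → β ∙ ((β ∙ (a ∙ (β ⁻¹))) ∙ (β ⁻¹)) ≡ a) →
    (∃ λ a → a ∈ A × β ∙ (a ∙ (β ⁻¹)) ≢ a) →
    β ∙ (α ∙ (β ⁻¹)) ≡ α →
    α ≢ e →
    (μ lam t : ℕ) → 2 * μ + 1 ≡ n → 2 * lam + 3 ≡ n → t ≡ μ →
    (S : Subset (2 * n)) → e ∉ S →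
    ¬ IsDSRG (λ x y → lookup S (y ∙ (x ⁻¹))) (n ∸ 1) μ lam t
corollary4 n _ _∙_ e _⁻¹ isGroup _ A e∈A ∙-closed ⁻¹-closed ∙-comm ∣A∣≡n β α β∉A _ α∈A _ _ fα≡α α≢e
           μ lam t 2μ+1≡n 2lam+3≡n t≡μ S e∉S dsrg =
  let h , ∣A∣≡2h = ∣A∣-even in even≢odd h μ (begin
    2 * h        ≡⟨ ∣A∣≡2h ⟨
    count inA    ≡⟨ count-inA ⟩
    n            ≡⟨ 2μ+1≡n ⟨
    2 * μ + 1    ≡⟨ +-comm (2 * μ) 1 ⟩
    1 + 2 * μ    ∎)
  where
  open ≡-Reasoning
  open FiniteGroup isGroup
  open CayleyDSRG S e∉S dsrg
  open IndexTwo isGroup A e∈A ∙-closed ⁻¹-closed ∣A∣≡n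
  open Transfer ∙-comm (∉⇒lookup≡false β∉A)

  lam+1≡μ : lam + 1 ≡ μ
  lam+1≡μ = *-cancelˡ-≡ _ _ 2 (+-cancelʳ-≡ 1 _ _ (trans (shift lam) (trans 2lam+3≡n (sym 2μ+1≡n))))
    where
    shift : ∀ l → 2 * (l + 1) + 1 ≡ 2 * l + 3
    shift = solve-∀

  ∣S∣≡2μ : count (lookup S) ≡ 2 * μ
  ∣S∣≡2μ = trans ∣S∣≡k (trans (cong (_∸ 1) (sym 2μ+1≡n)) (m+n∸n≡m (2 * μ) 1))

  open KernelCount S 2μ+1≡n ∣S∣≡2μ (S²+S≡μG t≡μ lam+1≡μ)

  α²≡ε : α ∙ α ≡ e
  α²≡ε = begin
    α ∙ α          ≡⟨ cong (α ∙_) fα≡α ⟨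
    α ∙ f α        ≡⟨ transfer-∈A ([]=⇒lookup α∈A) ⟨
    transfer α     ≡⟨ transfer-trivial ([]=⇒lookup α∈A) ⟩
    e              ∎

  ∣A∣-even : Σ[ h ∈ ℕ ] count inA ≡ 2 * h
  ∣A∣-even = count-involution-even inA (_∙ α)
    (λ x → trans (assoc x α α) (trans (cong (x ∙_) α²≡ε) (identityʳ x)))
    (λ x xα≡x → α≢e (∙-cancelˡ x α e (trans xα≡x (sym (identityʳ x)))))
    (λ x → inA-∙ʳ x ([]=⇒lookup α∈A))
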